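{- For every integer $k\ge4$, the thick headless spider $\overline{H}_k$ satisfies $\gamma^{\mathrm{ITD}}(\overline{H}_k)=k+1$ and $\gamma^{\mathrm{FD}}(\overline{H}_k)=\gamma^{\mathrm{FTD}}(\overline{H}_k)=2k-2$.
   Context: The thick headless spider $\overline{H}_k$ is the graph on vertex set $Q\cup S$ with $Q=\{q_1,\dots,q_k\}$ a clique, $S=\{s_1,\dots,s_k\}$ a stable set, and $s_i$ adjacent to $q_j$ if and only if $i\neq j$. For a vertex $v$, $N(v)$ is its open and $N[v]=N(v)\cup\{v\}$ its closed neighborhood. A vertex set $C$ is dominating if $N[v]\cap C\neq\emptyset$ for all $v$; total-dominating if $N(v)\cap C\neq\emptyset$ for all $v$; closed-separating if the sets $N[v]\cap C$ are pairwise distinct over all vertices $v$; full-separating if for all distinct $u,v$, $(N(v)\cap C)\setminus\{u\}\neq(N(u)\cap C)\setminus\{v\}$. An ITD-code is a closed-separating total-dominating set, an FD-code a full-separating dominating set, and an FTD-code a full-separating total-dominating set; $\gamma^{X}$ denotes the minimum cardinality of an X-code. -}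

module Defs where

open import Data.Nat using (ℕ; _+_; _≤_)
open import Data.Fin using (Fin; splitAt)
open import Data.Fin.Subset using (Subset; _∈_; ∣_∣)
open import Data.Sum using (_⊎_; inj₁; inj₂)
open import Data.Product using (_×_; ∃; Σ)
open import Data.Empty using (⊥)
open import Relation.Binary.PropositionalEquality using (_≡_; _≢_)
open import Relation.Nullary using (¬_)
open import Function.Bundles using (_⇔_)

record Graph : Set₁ where
  field
    n   : ℕ
    Adj : Fin n → Fin n → Set

module _ (G : Graph) where
  open Graph G

  InN : Fin n → Fin n → Set
  InN v w = Adj v w

  InNc : Fin n → Fin n → Set
  InNc v w = (w ≡ v) ⊎ Adj v w

  Dominating : Subset n → Set
  Dominating C = ∀ v → ∃ λ w → InNc v w × w ∈ C

  TotalDominating : Subset n → Set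
  TotalDominating C = ∀ v → ∃ λ w → InN v w × w ∈ C

  ClosedSeparating : Subset n → Set
  ClosedSeparating C = ∀ u v → u ≢ v →
    ¬ (∀ w → ((InNc u w × w ∈ C) ⇔ (InNc v w × w ∈ C)))

  FullSeparating : Subset n → Set
  FullSeparating C = ∀ u v → u ≢ v →
    ¬ (∀ w → ((InN v w × w ∈ C × w ≢ u) ⇔ (InN u w × w ∈ C × w ≢ v)))

  ITDCode : Subset n → Set
  ITDCode C = ClosedSeparating C × TotalDominating C

  FDCode : Subset n → Set
  FDCode C = FullSeparating C × Dominating C

  FTDCode : Subset n → Set
  FTDCode C = FullSeparating C × TotalDominating C

IsMinCodeSize : (G : Graph) → (Subset (Graph.n G) → Set) → ℕ → Set
IsMinCodeSize G X m =
  (Σ (Subset (Graph.n G)) λ C → X C × ∣ C ∣ ≡ m) ×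
  (∀ C → X C → m ≤ ∣ C ∣)

-- Thick headless spider: vertices Fin (k + k); the first k are the clique
-- Q (q_i ↦ i), the last k the stable set S (s_i ↦ k + i).
spiderAdj : (k : ℕ) → Fin (k + k) → Fin (k + k) → Set
spiderAdj k u v with splitAt k u | splitAt k v
... | inj₁ i | inj₁ j = i ≢ j
... | inj₁ i | inj₂ j = i ≢ j
... | inj₂ i | inj₁ j = i ≢ j
... | inj₂ i | inj₂ j = ⊥

thickHeadlessSpider : ℕ → Graph
thickHeadlessSpider k = record { n = k + k ; Adj = spiderAdj k }

module Submission where

-- Q is a clique, S is stable and s_i ~ q_j exactly when i ≠ j.  For i ≠ j the
-- sets compared when separating q_i from q_j therefore differ only in s_i and
-- s_j, so a full- or closed-separating code misses at most one vertex of S;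
-- likewise full separation of s_i from s_j forces q_i or q_j into the code.
-- This gives |C| ≥ 2k − 2 for full-separating codes and |C| ≥ (k − 1) + 2 for
-- ITD-codes, since totally dominating s_i and then s_m takes two vertices of Q.
-- The bounds are attained by (Q ∖ {q₀}) ∪ (S ∖ {s₀}) and {q₀, q₁} ∪ (S ∖ {s₀});
-- k ≥ 4 makes every pair q_i, s_j separated by some s_m with m ∉ {0, i, j}.

open import Defs
open import Data.Bool.Base using (true; false)
open import Data.Empty using (⊥-elim)
open import Data.Fin.Base using (Fin; zero; suc; _↑ˡ_; _↑ʳ_; splitAt)
open import Data.Fin.Properties
  using (_≟_; ¬∀⟶∃¬; ↑ˡ-injective; ↑ʳ-injective; splitAt-↑ˡ; splitAt-↑ʳ; splitAt⁻¹-↑ˡ; splitAt⁻¹-↑ʳ)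
open import Data.Fin.Subset using (Subset; _∈_; _∉_; ∣_∣; ⊤; ⊥; ∁; ⁅_⁆; _∪_; inside)
open import Data.Fin.Subset.Properties
  using (_∈?_; nonempty?; Empty-unique; ∣⊥∣≡0; ∣⊤∣≡n; ∣⁅x⁆∣≡1; ∣∁p∣≡n∸∣p∣; ∣p∣≤∣x∷p∣;
         p⊆q⇒∣p∣≤∣q∣; x∈p⇒∣p-x∣<∣p∣; x∈p∧x≢y⇒x∈p-y; x∈⁅x⁆; x∈⁅y⁆⇒x≡y; x≢y⇒x∉⁅y⁆;
         x∈p∪q⁺; x∉p⇒x∈∁p; x∈∁p⇒x∉p)
open import Data.Nat.Base using (ℕ; suc; _+_; _*_; _∸_; _≤_; _<_; z≤n; s≤s)
open import Data.Nat.Properties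
  using (≤-trans; ≤-reflexive; ≤-<-trans; <⇒≱; +-monoʳ-≤; +-mono-≤; +-suc; +-comm;
         +-identityʳ; *-distribˡ-∸; m≤n+m∸n; m≤n+o⇒m∸n≤o; module ≤-Reasoning)
open import Data.Product using (∃; _×_; _,_; proj₁)
open import Data.Sum using (inj₁; inj₂; [_,_])
open import Data.Vec.Base using (Vec; []; _∷_; _++_; count; here; there)
import Data.Vec.Base as Vec
open import Data.Vec.Properties using (lookup-++ˡ; lookup-++ʳ; []=⇒lookup; lookup⇒[]=)
open import Function.Base using (_∘_)
open import Function.Bundles using (_⇔_; mk⇔; Equivalence)
import Function.Properties.Equivalence as ⇔
open import Relation.Binary.PropositionalEquality
  using (_≡_; _≢_; refl; sym; trans; cong; cong₂; subst; module ≡-Reasoning)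
open import Relation.Nullary using (¬_; yes; no; does)
open import Relation.Nullary.Decidable using (decidable-stable)
open import Relation.Unary using (Pred; Decidable)

count-++ : ∀ {a p} {A : Set a} {P : Pred A p} (P? : Decidable P) {m n}
           (xs : Vec A m) (ys : Vec A n) →
           count P? (xs ++ ys) ≡ count P? xs + count P? ys
count-++ P? []       ys = refl
count-++ P? (x ∷ xs) ys with does (P? x)
... | true  = cong suc (count-++ P? xs ys)
... | false = count-++ P? xs ys

∣p++q∣≡∣p∣+∣q∣ : ∀ {m n} (p : Subset m) (q : Subset n) → ∣ p ++ q ∣ ≡ ∣ p ∣ + ∣ q ∣
∣p++q∣≡∣p∣+∣q∣ = count-++ _

x∈p⇒x↑ˡ∈p++q : ∀ {m n} {p : Subset m} {q : Subset n} {x} → x ∈ p → x ↑ˡ n ∈ p ++ q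
x∈p⇒x↑ˡ∈p++q {p = p} {q} {x} x∈p =
  lookup⇒[]= _ (p ++ q) (trans (lookup-++ˡ p q x) ([]=⇒lookup x∈p))

x↑ˡ∈p++q⇒x∈p : ∀ {m n} {p : Subset m} {q : Subset n} {x} → x ↑ˡ n ∈ p ++ q → x ∈ p
x↑ˡ∈p++q⇒x∈p {p = p} {q} {x} x∈p++q =
  lookup⇒[]= x p (trans (sym (lookup-++ˡ p q x)) ([]=⇒lookup x∈p++q))

x∈q⇒x↑ʳ∈p++q : ∀ {m n} {p : Subset m} {q : Subset n} {x} → x ∈ q → m ↑ʳ x ∈ p ++ q
x∈q⇒x↑ʳ∈p++q {p = p} {q} {x} x∈q =
  lookup⇒[]= _ (p ++ q) (trans (lookup-++ʳ p q x) ([]=⇒lookup x∈q))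

x↑ʳ∈p++q⇒x∈q : ∀ {m n} {p : Subset m} {q : Subset n} {x} → m ↑ʳ x ∈ p ++ q → x ∈ q
x↑ʳ∈p++q⇒x∈q {p = p} {q} {x} x∈p++q =
  lookup⇒[]= x q (trans (sym (lookup-++ʳ p q x)) ([]=⇒lookup x∈p++q))

x∉p∧y∈p⇒x≢y : ∀ {n} {p : Subset n} {x y} → x ∉ p → y ∈ p → x ≢ y
x∉p∧y∈p⇒x≢y x∉p y∈p refl = x∉p y∈p

∣p∪q∣≤∣p∣+∣q∣ : ∀ {n} (p q : Subset n) → ∣ p ∪ q ∣ ≤ ∣ p ∣ + ∣ q ∣
∣p∪q∣≤∣p∣+∣q∣ []          []          = z≤n
∣p∪q∣≤∣p∣+∣q∣ (true  ∷ p) (y ∷ q)     =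
  s≤s (≤-trans (∣p∪q∣≤∣p∣+∣q∣ p q) (+-monoʳ-≤ ∣ p ∣ (∣p∣≤∣x∷p∣ y q)))
∣p∪q∣≤∣p∣+∣q∣ (false ∷ p) (true  ∷ q) =
  ≤-trans (s≤s (∣p∪q∣≤∣p∣+∣q∣ p q)) (≤-reflexive (sym (+-suc ∣ p ∣ ∣ q ∣)))
∣p∪q∣≤∣p∣+∣q∣ (false ∷ p) (false ∷ q) = ∣p∪q∣≤∣p∣+∣q∣ p q

x∈p⇒0<∣p∣ : ∀ {n} {p : Subset n} {x} → x ∈ p → 0 < ∣ p ∣
x∈p⇒0<∣p∣ {x = x} x∈p = subst (_≤ _) (∣⁅x⁆∣≡1 x)
  (p⊆q⇒∣p∣≤∣q∣ λ y∈⁅x⁆ → subst (_∈ _) (sym (x∈⁅y⁆⇒x≡y x y∈⁅x⁆)) x∈p)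

x≢y⇒x∈p⇒y∈p⇒2≤∣p∣ : ∀ {n} {p : Subset n} {x y} → x ≢ y → x ∈ p → y ∈ p → 2 ≤ ∣ p ∣
x≢y⇒x∈p⇒y∈p⇒2≤∣p∣ x≢y x∈p y∈p =
  ≤-trans (s≤s (x∈p⇒0<∣p∣ (x∈p∧x≢y⇒x∈p-y y∈p (x≢y ∘ sym)))) (x∈p⇒∣p-x∣<∣p∣ x∈p)

subsingleton⇒∣p∣≤1 : ∀ {n} {p : Subset n} →
                     (∀ {x y} → x ∈ p → y ∈ p → x ≡ y) → ∣ p ∣ ≤ 1
subsingleton⇒∣p∣≤1 {n} {p} unique with nonempty? p
... | yes (x , x∈p) = ≤-trans (p⊆q⇒∣p∣≤∣q∣ λ y∈p → subst (_∈ ⁅ x ⁆) (unique x∈p y∈p) (x∈⁅x⁆ x))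
                              (≤-reflexive (∣⁅x⁆∣≡1 x))
... | no ∄x = ≤-trans (≤-reflexive (trans (cong ∣_∣ (Empty-unique ∄x)) (∣⊥∣≡0 n))) z≤n

missing≤1⇒n∸1≤∣p∣ : ∀ {n} {p : Subset n} →
                    (∀ {x y} → x ∉ p → y ∉ p → x ≡ y) → n ∸ 1 ≤ ∣ p ∣
missing≤1⇒n∸1≤∣p∣ {n} {p} unique = m≤n+o⇒m∸n≤o n 1 (begin
  n                   ≤⟨ m≤n+m∸n n ∣ p ∣ ⟩
  ∣ p ∣ + (n ∸ ∣ p ∣)   ≡⟨ cong (∣ p ∣ +_) (sym (∣∁p∣≡n∸∣p∣ p)) ⟩
  ∣ p ∣ + ∣ ∁ p ∣       ≤⟨ +-monoʳ-≤ ∣ p ∣ (subsingleton⇒∣p∣≤1 ∁p-unique) ⟩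
  ∣ p ∣ + 1             ≡⟨ +-comm ∣ p ∣ 1 ⟩
  1 + ∣ p ∣             ∎)
  where
  open ≤-Reasoning
  ∁p-unique : ∀ {x y} → x ∈ ∁ p → y ∈ ∁ p → x ≡ y
  ∁p-unique x∈∁p y∈∁p = unique (x∈∁p⇒x∉p x∈∁p) (x∈∁p⇒x∉p y∈∁p)

∣p∣<n⇒∃∉p : ∀ {n} {p : Subset n} → ∣ p ∣ < n → ∃ λ x → x ∉ p
∣p∣<n⇒∃∉p {n} {p} ∣p∣<n = ¬∀⟶∃¬ n (_∈ p) (_∈? p) λ all∈p → <⇒≱ ∣p∣<n (begin
  n          ≡⟨ sym (∣⊤∣≡n n) ⟩
  ∣ ⊤ {n} ∣  ≤⟨ p⊆q⇒∣p∣≤∣q∣ {p = ⊤} (λ {x} _ → all∈p x) ⟩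
  ∣ p ∣      ∎)
  where open ≤-Reasoning

∃-avoiding-three : ∀ {n} → 3 < n → (a b c : Fin n) → ∃ λ x → x ≢ a × x ≢ b × x ≢ c
∃-avoiding-three 3<n a b c with ∣p∣<n⇒∃∉p {p = ⁅ a ⁆ ∪ ⁅ b ⁆ ∪ ⁅ c ⁆} (≤-<-trans ∣abc∣≤3 3<n)
  where
  open ≤-Reasoning
  ∣abc∣≤3 : ∣ ⁅ a ⁆ ∪ ⁅ b ⁆ ∪ ⁅ c ⁆ ∣ ≤ 3
  ∣abc∣≤3 = begin
    ∣ ⁅ a ⁆ ∪ ⁅ b ⁆ ∪ ⁅ c ⁆ ∣           ≤⟨ ∣p∪q∣≤∣p∣+∣q∣ ⁅ a ⁆ _ ⟩
    ∣ ⁅ a ⁆ ∣ + ∣ ⁅ b ⁆ ∪ ⁅ c ⁆ ∣       ≤⟨ +-monoʳ-≤ ∣ ⁅ a ⁆ ∣ (∣p∪q∣≤∣p∣+∣q∣ ⁅ b ⁆ ⁅ c ⁆) ⟩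
    ∣ ⁅ a ⁆ ∣ + (∣ ⁅ b ⁆ ∣ + ∣ ⁅ c ⁆ ∣) ≡⟨ cong₂ _+_ (∣⁅x⁆∣≡1 a)
                                            (cong₂ _+_ (∣⁅x⁆∣≡1 b) (∣⁅x⁆∣≡1 c)) ⟩
    3                                   ∎
... | x , x∉abc = x
                , x∉abc ∘ x∈p∪q⁺ ∘ inj₁ ∘ x≡y⇒x∈⁅y⁆
                , x∉abc ∘ x∈p∪q⁺ ∘ inj₂ ∘ x∈p∪q⁺ ∘ inj₁ ∘ x≡y⇒x∈⁅y⁆
                , x∉abc ∘ x∈p∪q⁺ ∘ inj₂ ∘ x∈p∪q⁺ ∘ inj₂ ∘ x≡y⇒x∈⁅y⁆
  where
  x≡y⇒x∈⁅y⁆ : ∀ {y} → x ≡ y → x ∈ ⁅ y ⁆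
  x≡y⇒x∈⁅y⁆ refl = x∈⁅x⁆ x

2*n∸2≡[n∸1]+[n∸1] : ∀ n → 2 * n ∸ 2 ≡ (n ∸ 1) + (n ∸ 1)
2*n∸2≡[n∸1]+[n∸1] n = begin
  2 * n ∸ 2           ≡⟨ sym (*-distribˡ-∸ 2 n 1) ⟩
  2 * (n ∸ 1)         ≡⟨ cong ((n ∸ 1) +_) (+-identityʳ (n ∸ 1)) ⟩
  (n ∸ 1) + (n ∸ 1)   ∎
  where open ≡-Reasoning

Separated : {X : Set} → (X → Set) → (X → Set) → Set
Separated A B = ¬ (∀ x → A x ⇔ B x)

module _ {X : Set} {A B : X → Set} where

  separatedˡ : ∀ x → A x → ¬ B x → Separated A B
  separatedˡ x a ¬b A⇔B = ¬b (Equivalence.to (A⇔B x) a)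

  separatedʳ : ∀ x → ¬ A x → B x → Separated A B
  separatedʳ x ¬a b A⇔B = ¬a (Equivalence.from (A⇔B x) b)

  separated-sym : Separated A B → Separated B A
  separated-sym sep B⇔A = sep (λ x → ⇔.sym (B⇔A x))

total-dominating⇒dominating : ∀ G {C} → TotalDominating G C → Dominating G C
total-dominating⇒dominating G td v with td v
... | w , v~w , w∈C = w , inj₂ v~w , w∈C

module Spider (k : ℕ) where

  G : Graph
  G = thickHeadlessSpider k

  V : Set
  V = Fin (k + k)

  infix 4 _~_
  _~_ : V → V → Set
  _~_ = spiderAdj k

  q s : Fin k → V
  q i = i ↑ˡ k
  s i = k ↑ʳ i

  data View : V → Set where
    inQ : ∀ i → View (q i)
    inS : ∀ i → View (s i)

  view : ∀ v → View v
  view v with splitAt k v in eq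
  ... | inj₁ i = subst View (splitAt⁻¹-↑ˡ eq) (inQ i)
  ... | inj₂ i = subst View (splitAt⁻¹-↑ʳ eq) (inS i)

  q-injective : ∀ {i j} → q i ≡ q j → i ≡ j
  q-injective = ↑ˡ-injective k _ _

  s-injective : ∀ {i j} → s i ≡ s j → i ≡ j
  s-injective = ↑ʳ-injective k _ _

  q≢s : ∀ {i j} → q i ≢ s j
  q≢s {i} {j} qi≡sj
    with trans (sym (splitAt-↑ˡ k i k)) (trans (cong (splitAt k) qi≡sj) (splitAt-↑ʳ k k j))
  ... | ()

  q~q⁺ : ∀ {i j} → i ≢ j → q i ~ q j
  q~q⁺ {i} {j} i≢j rewrite splitAt-↑ˡ k i k | splitAt-↑ˡ k j k = i≢j

  q~q⁻ : ∀ {i j} → q i ~ q j → i ≢ j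
  q~q⁻ {i} {j} qi~qj rewrite splitAt-↑ˡ k i k | splitAt-↑ˡ k j k = qi~qj

  q~s⁺ : ∀ {i j} → i ≢ j → q i ~ s j
  q~s⁺ {i} {j} i≢j rewrite splitAt-↑ˡ k i k | splitAt-↑ʳ k k j = i≢j

  q~s⁻ : ∀ {i j} → q i ~ s j → i ≢ j
  q~s⁻ {i} {j} qi~sj rewrite splitAt-↑ˡ k i k | splitAt-↑ʳ k k j = qi~sj

  s~q⁺ : ∀ {i j} → i ≢ j → s i ~ q j
  s~q⁺ {i} {j} i≢j rewrite splitAt-↑ʳ k k i | splitAt-↑ˡ k j k = i≢j

  s~q⁻ : ∀ {i j} → s i ~ q j → i ≢ j
  s~q⁻ {i} {j} si~qj rewrite splitAt-↑ʳ k k i | splitAt-↑ˡ k j k = si~qj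

  s≁s : ∀ {i j} → ¬ (s i ~ s j)
  s≁s {i} {j} si~sj rewrite splitAt-↑ʳ k k i | splitAt-↑ʳ k k j = si~sj

  qᵢ≁sᵢ : ∀ {i} → ¬ (q i ~ s i)
  qᵢ≁sᵢ qi~si = q~s⁻ qi~si refl

  sᵢ≁qᵢ : ∀ {i} → ¬ (s i ~ q i)
  sᵢ≁qᵢ si~qi = s~q⁻ si~qi refl

  sᵢ∉N[qᵢ] : ∀ {i} → ¬ InNc G (q i) (s i)
  sᵢ∉N[qᵢ] = [ q≢s ∘ sym , qᵢ≁sᵢ ]

  sᵢ∉N[sⱼ] : ∀ {i j} → i ≢ j → ¬ InNc G (s j) (s i)
  sᵢ∉N[sⱼ] i≢j = [ i≢j ∘ s-injective , s≁s ]

  N∩∖ : Subset (k + k) → V → V → V → Set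
  N∩∖ C v u w = InN G v w × w ∈ C × w ≢ u

  N[]∩ : Subset (k + k) → V → V → Set
  N[]∩ C v w = InNc G v w × w ∈ C

  partners⇒total-dominating : ∀ {C} → (∀ i → ∃ λ m → i ≢ m × q m ∈ C) → TotalDominating G C
  partners⇒total-dominating partner v with view v
  ... | inQ i with partner i
  ...   | m , i≢m , qm∈C = q m , q~q⁺ i≢m , qm∈C
  partners⇒total-dominating partner v | inS i with partner i
  ...   | m , i≢m , qm∈C = q m , s~q⁺ i≢m , qm∈C

  module Split (xs ys : Subset k) where

    C : Subset (k + k)
    C = xs ++ ys

    N∩∖-qⱼ⊆N∩∖-qᵢ : ∀ {i j} → i ∉ ys → ∀ w → N∩∖ C (q j) (q i) w → N∩∖ C (q i) (q j) w
    N∩∖-qⱼ⊆N∩∖-qᵢ i∉ys w w∈ with view w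
    N∩∖-qⱼ⊆N∩∖-qᵢ i∉ys _ (qj~qm , qm∈C , qm≢qi) | inQ m =
      q~q⁺ (qm≢qi ∘ cong q ∘ sym) , qm∈C , q~q⁻ qj~qm ∘ sym ∘ q-injective
    N∩∖-qⱼ⊆N∩∖-qᵢ i∉ys _ (_ , sm∈C , _) | inS m =
      q~s⁺ (x∉p∧y∈p⇒x≢y i∉ys (x↑ʳ∈p++q⇒x∈q sm∈C)) , sm∈C , q≢s ∘ sym

    N∩∖-sⱼ⊆N∩∖-sᵢ : ∀ {i j} → i ∉ xs → ∀ w → N∩∖ C (s j) (s i) w → N∩∖ C (s i) (s j) w
    N∩∖-sⱼ⊆N∩∖-sᵢ i∉xs w w∈ with view w
    N∩∖-sⱼ⊆N∩∖-sᵢ i∉xs _ (_ , qm∈C , _) | inQ m =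
      s~q⁺ (x∉p∧y∈p⇒x≢y i∉xs (x↑ˡ∈p++q⇒x∈p qm∈C)) , qm∈C , q≢s
    N∩∖-sⱼ⊆N∩∖-sᵢ i∉xs _ (sj~sm , _) | inS m = ⊥-elim (s≁s sj~sm)

    N[qᵢ]∩⊆N[qⱼ]∩ : ∀ {i j} → j ∉ ys → ∀ w → N[]∩ C (q i) w → N[]∩ C (q j) w
    N[qᵢ]∩⊆N[qⱼ]∩ {j = j} j∉ys w w∈ with view w
    N[qᵢ]∩⊆N[qⱼ]∩ {j = j} j∉ys _ (_ , qm∈C) | inQ m with j ≟ m
    ... | yes refl = inj₁ refl , qm∈C
    ... | no j≢m   = inj₂ (q~q⁺ j≢m) , qm∈C
    N[qᵢ]∩⊆N[qⱼ]∩ j∉ys _ (_ , sm∈C) | inS m =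
      inj₂ (q~s⁺ (x∉p∧y∈p⇒x≢y j∉ys (x↑ʳ∈p++q⇒x∈q sm∈C))) , sm∈C

    full-separating⇒ys-misses≤1 : FullSeparating G C → ∀ {i j} → i ∉ ys → j ∉ ys → i ≡ j
    full-separating⇒ys-misses≤1 fs {i} {j} i∉ys j∉ys = decidable-stable (i ≟ j) λ i≢j →
      fs (q i) (q j) (i≢j ∘ q-injective)
        λ w → mk⇔ (N∩∖-qⱼ⊆N∩∖-qᵢ i∉ys w) (N∩∖-qⱼ⊆N∩∖-qᵢ j∉ys w)

    full-separating⇒xs-misses≤1 : FullSeparating G C → ∀ {i j} → i ∉ xs → j ∉ xs → i ≡ j
    full-separating⇒xs-misses≤1 fs {i} {j} i∉xs j∉xs = decidable-stable (i ≟ j) λ i≢j →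
      fs (s i) (s j) (i≢j ∘ s-injective)
        λ w → mk⇔ (N∩∖-sⱼ⊆N∩∖-sᵢ i∉xs w) (N∩∖-sⱼ⊆N∩∖-sᵢ j∉xs w)

    closed-separating⇒ys-misses≤1 : ClosedSeparating G C → ∀ {i j} → i ∉ ys → j ∉ ys → i ≡ j
    closed-separating⇒ys-misses≤1 cs {i} {j} i∉ys j∉ys = decidable-stable (i ≟ j) λ i≢j →
      cs (q i) (q j) (i≢j ∘ q-injective)
        λ w → mk⇔ (N[qᵢ]∩⊆N[qⱼ]∩ j∉ys w) (N[qᵢ]∩⊆N[qⱼ]∩ i∉ys w)

    total-dominating⇒partners : TotalDominating G C → ∀ i → ∃ λ m → m ≢ i × m ∈ xs
    total-dominating⇒partners td i with td (s i)
    ... | w , si~w , w∈C with view w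
    ...   | inQ m = m , s~q⁻ si~w ∘ sym , x↑ˡ∈p++q⇒x∈p w∈C
    ...   | inS m = ⊥-elim (s≁s si~w)

    total-dominating⇒2≤∣xs∣ : Fin k → TotalDominating G C → 2 ≤ ∣ xs ∣
    total-dominating⇒2≤∣xs∣ i td with total-dominating⇒partners td i
    ... | m , _ , m∈xs with total-dominating⇒partners td m
    ...   | m′ , m′≢m , m′∈xs = x≢y⇒x∈p⇒y∈p⇒2≤∣p∣ m′≢m m′∈xs m∈xs

    open ≤-Reasoning

    full-separating⇒2k∸2≤∣C∣ : FullSeparating G C → 2 * k ∸ 2 ≤ ∣ C ∣
    full-separating⇒2k∸2≤∣C∣ fs = begin
      2 * k ∸ 2           ≡⟨ 2*n∸2≡[n∸1]+[n∸1] k ⟩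
      (k ∸ 1) + (k ∸ 1)   ≤⟨ +-mono-≤ (missing≤1⇒n∸1≤∣p∣ (full-separating⇒xs-misses≤1 fs))
                                      (missing≤1⇒n∸1≤∣p∣ (full-separating⇒ys-misses≤1 fs)) ⟩
      ∣ xs ∣ + ∣ ys ∣       ≡⟨ sym (∣p++q∣≡∣p∣+∣q∣ xs ys) ⟩
      ∣ C ∣               ∎

    itd-code⇒2+[k∸1]≤∣C∣ : Fin k → ITDCode G C → 2 + (k ∸ 1) ≤ ∣ C ∣
    itd-code⇒2+[k∸1]≤∣C∣ i (cs , td) = begin
      2 + (k ∸ 1)       ≤⟨ +-mono-≤ (total-dominating⇒2≤∣xs∣ i td)
                                    (missing≤1⇒n∸1≤∣p∣ (closed-separating⇒ys-misses≤1 cs)) ⟩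
      ∣ xs ∣ + ∣ ys ∣     ≡⟨ sym (∣p++q∣≡∣p∣+∣q∣ xs ys) ⟩
      ∣ C ∣             ∎

  full-separating⇒2k∸2≤∣C∣ : ∀ C → FullSeparating G C → 2 * k ∸ 2 ≤ ∣ C ∣
  full-separating⇒2k∸2≤∣C∣ C with Vec.splitAt k C
  ... | xs , ys , refl = Split.full-separating⇒2k∸2≤∣C∣ xs ys

  itd-code⇒2+[k∸1]≤∣C∣ : Fin k → ∀ C → ITDCode G C → 2 + (k ∸ 1) ≤ ∣ C ∣
  itd-code⇒2+[k∸1]≤∣C∣ i C with Vec.splitAt k C
  ... | xs , ys , refl = Split.itd-code⇒2+[k∸1]≤∣C∣ xs ys i

module Codes (k′ : ℕ) where

  k : ℕ
  k = 4 + k′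

  open Spider k public

  3<k : 3 < k
  3<k = s≤s (s≤s (s≤s (s≤s z≤n)))

  ∁⁅0⁆ : Subset k
  ∁⁅0⁆ = ∁ ⁅ zero ⁆

  ⁅0,1⁆ : Subset k
  ⁅0,1⁆ = inside ∷ inside ∷ ⊥

  i≢0⇒i∈∁⁅0⁆ : ∀ {i} → i ≢ zero → i ∈ ∁⁅0⁆
  i≢0⇒i∈∁⁅0⁆ = x∉p⇒x∈∁p ∘ x≢y⇒x∉⁅y⁆

  ∣∁⁅0⁆∣≡k∸1 : ∣ ∁⁅0⁆ ∣ ≡ k ∸ 1
  ∣∁⁅0⁆∣≡k∸1 = trans (∣∁p∣≡n∸∣p∣ ⁅ zero {k ∸ 1} ⁆) (cong (k ∸_) (∣⁅x⁆∣≡1 (zero {k ∸ 1})))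

  ftdCode : Subset (k + k)
  ftdCode = ∁⁅0⁆ ++ ∁⁅0⁆

  q∈ftdCode : ∀ {i} → i ≢ zero → q i ∈ ftdCode
  q∈ftdCode = x∈p⇒x↑ˡ∈p++q {q = ∁⁅0⁆} ∘ i≢0⇒i∈∁⁅0⁆

  s∈ftdCode : ∀ {i} → i ≢ zero → s i ∈ ftdCode
  s∈ftdCode = x∈q⇒x↑ʳ∈p++q {p = ∁⁅0⁆} ∘ i≢0⇒i∈∁⁅0⁆

  ∣ftdCode∣≡2k∸2 : ∣ ftdCode ∣ ≡ 2 * k ∸ 2
  ∣ftdCode∣≡2k∸2 = begin
    ∣ ftdCode ∣             ≡⟨ ∣p++q∣≡∣p∣+∣q∣ ∁⁅0⁆ ∁⁅0⁆ ⟩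
    ∣ ∁⁅0⁆ ∣ + ∣ ∁⁅0⁆ ∣     ≡⟨ cong₂ _+_ ∣∁⁅0⁆∣≡k∸1 ∣∁⁅0⁆∣≡k∸1 ⟩
    (k ∸ 1) + (k ∸ 1)       ≡⟨ sym (2*n∸2≡[n∸1]+[n∸1] k) ⟩
    2 * k ∸ 2               ∎
    where open ≡-Reasoning

  ftd-qq-separated : ∀ {i j} → i ≢ j →
                     Separated (N∩∖ ftdCode (q j) (q i)) (N∩∖ ftdCode (q i) (q j))
  ftd-qq-separated {i} {j} i≢j with j ≟ zero
  ... | no j≢0    = separatedʳ (s j) (qᵢ≁sᵢ ∘ proj₁) (q~s⁺ i≢j , s∈ftdCode j≢0 , q≢s ∘ sym)
  ... | yes refl  = separatedˡ (s i) (q~s⁺ (i≢j ∘ sym) , s∈ftdCode i≢j , q≢s ∘ sym) (qᵢ≁sᵢ ∘ proj₁)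

  ftd-ss-separated : ∀ {i j} → i ≢ j →
                     Separated (N∩∖ ftdCode (s j) (s i)) (N∩∖ ftdCode (s i) (s j))
  ftd-ss-separated {i} {j} i≢j with j ≟ zero
  ... | no j≢0    = separatedʳ (q j) (sᵢ≁qᵢ ∘ proj₁) (s~q⁺ i≢j , q∈ftdCode j≢0 , q≢s)
  ... | yes refl  = separatedˡ (q i) (s~q⁺ (i≢j ∘ sym) , q∈ftdCode i≢j , q≢s) (sᵢ≁qᵢ ∘ proj₁)

  ftd-qs-separated : ∀ i j → Separated (N∩∖ ftdCode (s j) (q i)) (N∩∖ ftdCode (q i) (s j))
  ftd-qs-separated i j with ∃-avoiding-three 3<k zero i j
  ... | m , m≢0 , m≢i , m≢j =
    separatedʳ (s m) (s≁s ∘ proj₁) (q~s⁺ (m≢i ∘ sym) , s∈ftdCode m≢0 , m≢j ∘ s-injective)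

  ftd-full-separating : FullSeparating G ftdCode
  ftd-full-separating u v u≢v with view u | view v
  ... | inQ i | inQ j = ftd-qq-separated (u≢v ∘ cong q)
  ... | inS i | inS j = ftd-ss-separated (u≢v ∘ cong s)
  ... | inQ i | inS j = ftd-qs-separated i j
  ... | inS i | inQ j = separated-sym (ftd-qs-separated j i)

  ftd-total-dominating : TotalDominating G ftdCode
  ftd-total-dominating = partners⇒total-dominating λ i →
    let m , m≢0 , m≢i , _ = ∃-avoiding-three 3<k zero i i in m , m≢i ∘ sym , q∈ftdCode m≢0

  itdCode : Subset (k + k)
  itdCode = ⁅0,1⁆ ++ ∁⁅0⁆

  s∈itdCode : ∀ {i} → i ≢ zero → s i ∈ itdCode
  s∈itdCode = x∈q⇒x↑ʳ∈p++q {p = ⁅0,1⁆} ∘ i≢0⇒i∈∁⁅0⁆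

  ∣itdCode∣≡k+1 : ∣ itdCode ∣ ≡ k + 1
  ∣itdCode∣≡k+1 = begin
    ∣ itdCode ∣                    ≡⟨ ∣p++q∣≡∣p∣+∣q∣ ⁅0,1⁆ ∁⁅0⁆ ⟩
    2 + (∣ ⊥ {k ∸ 2} ∣ + ∣ ∁⁅0⁆ ∣)  ≡⟨ cong₂ (λ a b → 2 + (a + b)) (∣⊥∣≡0 (k ∸ 2)) ∣∁⁅0⁆∣≡k∸1 ⟩
    1 + k                          ≡⟨ +-comm 1 k ⟩
    k + 1                          ∎
    where open ≡-Reasoning

  itd-qq-separated : ∀ {i j} → i ≢ j → Separated (N[]∩ itdCode (q i)) (N[]∩ itdCode (q j))
  itd-qq-separated {i} {j} i≢j with j ≟ zero
  ... | no j≢0    = separatedˡ (s j) (inj₂ (q~s⁺ i≢j) , s∈itdCode j≢0) (sᵢ∉N[qᵢ] ∘ proj₁)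
  ... | yes refl  = separatedʳ (s i) (sᵢ∉N[qᵢ] ∘ proj₁) (inj₂ (q~s⁺ (i≢j ∘ sym)) , s∈itdCode i≢j)

  itd-ss-separated : ∀ {i j} → i ≢ j → Separated (N[]∩ itdCode (s i)) (N[]∩ itdCode (s j))
  itd-ss-separated {i} {j} i≢j with i ≟ zero
  ... | no i≢0    = separatedˡ (s i) (inj₁ refl , s∈itdCode i≢0) (sᵢ∉N[sⱼ] i≢j ∘ proj₁)
  ... | yes refl  =
    separatedʳ (s j) (sᵢ∉N[sⱼ] (i≢j ∘ sym) ∘ proj₁) (inj₁ refl , s∈itdCode (i≢j ∘ sym))

  itd-qs-separated : ∀ i j → Separated (N[]∩ itdCode (q i)) (N[]∩ itdCode (s j))
  itd-qs-separated i j with ∃-avoiding-three 3<k zero i j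
  ... | m , m≢0 , m≢i , m≢j =
    separatedˡ (s m) (inj₂ (q~s⁺ (m≢i ∘ sym)) , s∈itdCode m≢0) (sᵢ∉N[sⱼ] m≢j ∘ proj₁)

  itd-closed-separating : ClosedSeparating G itdCode
  itd-closed-separating u v u≢v with view u | view v
  ... | inQ i | inQ j = itd-qq-separated (u≢v ∘ cong q)
  ... | inS i | inS j = itd-ss-separated (u≢v ∘ cong s)
  ... | inQ i | inS j = itd-qs-separated i j
  ... | inS i | inQ j = separated-sym (itd-qs-separated j i)

  itd-total-dominating : TotalDominating G itdCode
  itd-total-dominating = partners⇒total-dominating λ where
    zero    → suc zero , (λ ()) , x∈p⇒x↑ˡ∈p++q {p = ⁅0,1⁆} {q = ∁⁅0⁆} (there here)
    (suc _) → zero , (λ ()) , x∈p⇒x↑ˡ∈p++q {p = ⁅0,1⁆} {q = ∁⁅0⁆} here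

theorem9 : (k : ℕ) → 4 ≤ k →
    IsMinCodeSize (thickHeadlessSpider k) (ITDCode (thickHeadlessSpider k)) (k + 1) ×
    IsMinCodeSize (thickHeadlessSpider k) (FDCode (thickHeadlessSpider k)) (2 * k ∸ 2) ×
    IsMinCodeSize (thickHeadlessSpider k) (FTDCode (thickHeadlessSpider k)) (2 * k ∸ 2)
theorem9 (suc (suc (suc (suc k′)))) (s≤s (s≤s (s≤s (s≤s z≤n)))) =
    ((itdCode , (itd-closed-separating , itd-total-dominating) , ∣itdCode∣≡k+1) , itd-lower)
  , ((ftdCode , (ftd-full-separating , ftd-dominating) , ∣ftdCode∣≡2k∸2)
    , λ C → full-separating⇒2k∸2≤∣C∣ C ∘ proj₁)
  , ((ftdCode , (ftd-full-separating , ftd-total-dominating) , ∣ftdCode∣≡2k∸2)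
    , λ C → full-separating⇒2k∸2≤∣C∣ C ∘ proj₁)
  where
  open Codes k′

  ftd-dominating : Dominating G ftdCode
  ftd-dominating = total-dominating⇒dominating G ftd-total-dominating

  itd-lower : ∀ C → ITDCode G C → k + 1 ≤ ∣ C ∣
  -- 1 + k and 2 + (k ∸ 1) coincide by computation, k being a successor
  itd-lower C = subst (_≤ ∣ C ∣) (+-comm 1 k) ∘ itd-code⇒2+[k∸1]≤∣C∣ zero C
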